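{- Let $T$ be a tree of diameter $2$. Then $\operatorname{con}(T\overline{T})=2n(T)-1$.
   Context: For a graph $G$ with complement $\overline{G}$, the complementary prism $G\overline{G}$ is the graph obtained from the disjoint union of $G$ and $\overline{G}$ by adding the perfect matching joining each vertex $v$ of $G$ to its copy $\overline{v}$ in $\overline{G}$. For a graph $H$, a set $S\subseteq V(H)$ is (geodesically) convex if every vertex on every shortest path between two vertices of $S$ belongs to $S$. The convexity number $\operatorname{con}(H)$ is the maximum cardinality of a proper (i.e. $\neq V(H)$) convex set of $H$. $n(T)=|V(T)|$. -}

module Defs where

open import Data.Nat using (ℕ; zero; suc; _≤_; _<_)
open import Data.Fin using (Fin; zero; suc; inject₁; fromℕ; splitAt)
open import Data.Fin.Subset using (Subset; _∈_; ⊤; ∣_∣)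
open import Data.Sum using (_⊎_; inj₁; inj₂)
open import Data.Product using (Σ; _×_; _,_; ∃; ∃-syntax)
open import Data.Empty using (⊥)
open import Function.Definitions using (Injective)
open import Relation.Nullary using (¬_)
open import Relation.Binary.PropositionalEquality using (_≡_; _≢_)

Rel : ℕ → Set₁
Rel n = Fin n → Fin n → Set

IsSimple : ∀ {n} → Rel n → Set
IsSimple {n} G = (∀ u v → G u v → G v u) × (∀ u → ¬ G u u)

Complement : ∀ {n} → Rel n → Rel n
Complement G u v = (u ≢ v) × (¬ G u v)

data Walk {n} (G : Rel n) : ℕ → Fin n → Fin n → Set where
  nil  : ∀ v → Walk G 0 v v
  cons : ∀ {k u v w} → G u v → Walk G k v w → Walk G (suc k) u w

data OnWalk {n} {G : Rel n} (x : Fin n) : ∀ {k u v} → Walk G k u v → Set where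
  on-nil   : OnWalk x (nil x)
  on-head  : ∀ {k v w} (e : G x v) (p : Walk G k v w) → OnWalk x (cons e p)
  on-tail  : ∀ {k u v w} (e : G u v) (p : Walk G k v w) → OnWalk x p → OnWalk x (cons e p)

Dist : ∀ {n} → Rel n → Fin n → Fin n → ℕ → Set
Dist G u v k = Walk G k u v × (∀ m → m < k → ¬ Walk G m u v)

Connected : ∀ {n} → Rel n → Set
Connected {n} G = ∀ (u v : Fin n) → ∃[ k ] Walk G k u v

HasCycle : ∀ {n} → Rel n → Set
HasCycle {n} G = ∃[ m ] Σ (Fin (suc (suc (suc m))) → Fin n) λ c →
  Injective _≡_ _≡_ c
  × (∀ (i : Fin (suc (suc m))) → G (c (inject₁ i)) (c (suc i)))
  × G (c (fromℕ (suc (suc m)))) (c zero)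

IsTree : ∀ {n} → Rel n → Set
IsTree G = IsSimple G × Connected G × ¬ HasCycle G

Diameter : ∀ {n} → Rel n → ℕ → Set
Diameter {n} G d =
  (∀ (u v : Fin n) → ∃[ k ] (k ≤ d × Walk G k u v))
  × ∃[ u ] ∃[ v ] Dist G u v d

PrismAdj⊎ : ∀ {n} → Rel n → Fin n ⊎ Fin n → Fin n ⊎ Fin n → Set
PrismAdj⊎ G (inj₁ u) (inj₁ v) = G u v
PrismAdj⊎ G (inj₂ u) (inj₂ v) = Complement G u v
PrismAdj⊎ G (inj₁ u) (inj₂ v) = u ≡ v
PrismAdj⊎ G (inj₂ u) (inj₁ v) = u ≡ v

-- the same graph on Fin (n + n): the first n vertices are G, the last n are Ḡ
ComplementaryPrism : ∀ {n} → Rel n → Rel (n Data.Nat.+ n)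
ComplementaryPrism {n} G x y = PrismAdj⊎ G (splitAt n x) (splitAt n y)

Convex : ∀ {N} → Rel N → Subset N → Set
Convex H S = ∀ u v k → u ∈ S → v ∈ S → Dist H u v k →
  (p : Walk H k u v) → ∀ x → OnWalk x p → x ∈ S

ConvexityNumber : ∀ {N} → Rel N → ℕ → Set
ConvexityNumber H m =
  (∃[ S ] (Convex H S × S ≢ ⊤ × ∣ S ∣ ≡ m))
  × (∀ S → Convex H S → S ≢ ⊤ → ∣ S ∣ ≤ m)

-- A tree of diameter 2 is a star: the middle vertex c of a diametral path is adjacent to
-- every other vertex, since otherwise a triangle, square or pentagon would appear.  Hence
-- c̄ is isolated in the complement, so in the prism c̄ has the single neighbour c.  Such a
-- pendant vertex is never interior to a geodesic, so removing it leaves a convex set of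
-- the largest size a proper subset can have.
module Submission where

open import Defs
open import Data.Nat using (ℕ; zero; suc; _*_; _+_; _∸_; _≤_; _<_; z≤n; s≤s)
open import Data.Nat.Properties using (+-identityʳ; n<1+n; m<n⇒m<1+n; ≤∧≢⇒<; <⇒≤pred)
open import Data.Fin using (Fin; zero; suc; inject₁; fromℕ; splitAt; _↑ʳ_; _≟_)
open import Data.Fin.Properties using (splitAt-↑ʳ; splitAt⁻¹-↑ˡ)
open import Data.Fin.Subset using (Subset; _∈_; ⊤; ∣_∣; ∁; ⁅_⁆)
open import Data.Fin.Subset.Properties
  using (∣p∣≤n; ∣p∣≡n⇒p≡⊤; ∣∁p∣≡n∸∣p∣; ∣⁅x⁆∣≡1; x∈⁅x⁆; x∈∁p⇒x∉p; x∉p⇒x∈∁p; x≢y⇒x∉⁅y⁆; ∈⊤)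
open import Data.Vec using (Vec; []; _∷_; lookup; head)
open import Data.Vec.Relation.Unary.All using ([]; _∷_)
open import Data.Vec.Relation.Unary.AllPairs using ([]; _∷_)
open import Data.Vec.Relation.Unary.Linked using (Linked; [-]; _∷_)
open import Data.Vec.Relation.Unary.Unique.Propositional using (Unique)
open import Data.Vec.Relation.Unary.Unique.Propositional.Properties using (lookup-injective)
open import Data.Sum using (_⊎_; inj₁; inj₂)
open import Data.Product using (_×_; _,_; proj₁; proj₂; ∃-syntax)
open import Data.Empty using (⊥; ⊥-elim)
open import Function using (_∘_)
open import Relation.Nullary using (¬_; yes; no)
open import Relation.Binary.PropositionalEquality using (_≡_; _≢_; refl; sym; trans; cong; subst)

linked-lookup : ∀ {A : Set} {R : A → A → Set} {k} {xs : Vec A (suc k)} → Linked R xs →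
  ∀ (i : Fin k) → R (lookup xs (inject₁ i)) (lookup xs (suc i))
linked-lookup {xs = _ ∷ _ ∷ _} (r ∷ _) zero = r
linked-lookup (_ ∷ rs) (suc i)              = linked-lookup rs i

linkedUnique⇒HasCycle : ∀ {n m} {G : Rel n} (vs : Vec (Fin n) (3 + m)) →
  Unique vs → Linked G vs → G (lookup vs (fromℕ (2 + m))) (head vs) → HasCycle G
linkedUnique⇒HasCycle vs@(_ ∷ _) unique linked closing =
  _ , lookup vs , (λ {i} {j} → lookup-injective unique i j) , linked-lookup linked , closing

module ShortCycles {n} {G : Rel n} (simple : IsSimple G) (acyclic : ¬ HasCycle G) where

  adj⇒≢ : ∀ {a b} → G a b → a ≢ b
  adj⇒≢ {b = b} ab refl = proj₂ simple b ab

  no-triangle : ∀ {a b c} → G a b → G b c → G c a → ⊥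
  no-triangle ab bc ca = acyclic (linkedUnique⇒HasCycle (_ ∷ _ ∷ _ ∷ [])
    ((adj⇒≢ ab ∷ adj⇒≢ ca ∘ sym ∷ []) ∷ (adj⇒≢ bc ∷ []) ∷ [] ∷ [])
    (ab ∷ bc ∷ [-]) ca)

  no-square : ∀ {a b c d} → a ≢ c → b ≢ d → G a b → G b c → G c d → G d a → ⊥
  no-square a≢c b≢d ab bc cd da = acyclic (linkedUnique⇒HasCycle (_ ∷ _ ∷ _ ∷ _ ∷ [])
    ((adj⇒≢ ab ∷ a≢c ∷ adj⇒≢ da ∘ sym ∷ []) ∷ (adj⇒≢ bc ∷ b≢d ∷ []) ∷ (adj⇒≢ cd ∷ []) ∷ [] ∷ [])
    (ab ∷ bc ∷ cd ∷ [-]) da)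

  no-pentagon : ∀ {a b c d e} → a ≢ c → a ≢ d → b ≢ d → b ≢ e → c ≢ e →
    G a b → G b c → G c d → G d e → G e a → ⊥
  no-pentagon a≢c a≢d b≢d b≢e c≢e ab bc cd de ea = acyclic (linkedUnique⇒HasCycle (_ ∷ _ ∷ _ ∷ _ ∷ _ ∷ [])
    ((adj⇒≢ ab ∷ a≢c ∷ a≢d ∷ adj⇒≢ ea ∘ sym ∷ []) ∷ (adj⇒≢ bc ∷ b≢d ∷ b≢e ∷ [])
      ∷ (adj⇒≢ cd ∷ c≢e ∷ []) ∷ (adj⇒≢ de ∷ []) ∷ [] ∷ [])
    (ab ∷ bc ∷ cd ∷ de ∷ [-]) ea)

module DiameterAtMostTwo {n} {G : Rel n} (simple : IsSimple G) (acyclic : ¬ HasCycle G)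
  (within2 : ∀ u v → ∃[ k ] (k ≤ 2 × Walk G k u v)) where

  open ShortCycles simple acyclic

  adj-sym : ∀ {a b} → G a b → G b a
  adj-sym = proj₁ simple _ _

  dist≤2 : ∀ x w → x ≡ w ⊎ G x w ⊎ ∃[ y ] (G x y × G y w)
  dist≤2 x w with within2 x w
  ... | 0 , _ , nil _                       = inj₁ refl
  ... | 1 , _ , cons xw (nil _)             = inj₂ (inj₁ xw)
  ... | 2 , _ , cons xy (cons yw (nil _))   = inj₂ (inj₂ (_ , xy , yw))
  ... | suc (suc (suc _)) , s≤s (s≤s ()) , _

  another-neighbour : ∀ {u w v} → G u w → G w v → u ≢ v → ∀ y → ∃[ z ] (z ≢ y × G w z)
  another-neighbour {u} {w} {v} uw wv u≢v y with u ≟ y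
  ... | yes refl = v , u≢v ∘ sym , wv
  ... | no u≢y   = u , u≢y , adj-sym uw

  centre-dominates : ∀ {u w v} → G u w → G w v → u ≢ v → ∀ x → x ≢ w → G w x
  centre-dominates {w = w} uw wv u≢v x x≢w with dist≤2 x w
  ... | inj₁ x≡w       = ⊥-elim (x≢w x≡w)
  ... | inj₂ (inj₁ xw) = adj-sym xw
  ... | inj₂ (inj₂ (y , xy , yw)) with another-neighbour uw wv u≢v y
  ...   | z , z≢y , wz with x ≟ z | dist≤2 x z
  ...     | yes refl | _              = wz
  ...     | no x≢z   | inj₁ x≡z       = ⊥-elim (x≢z x≡z)
  ...     | no x≢z   | inj₂ (inj₁ xz) =
    ⊥-elim (no-square x≢w z≢y xz (adj-sym wz) (adj-sym yw) (adj-sym xy))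
  ...     | no x≢z   | inj₂ (inj₂ (t , xt , tz)) with t ≟ w | t ≟ y
  ...       | yes refl | _        = adj-sym xt
  ...       | no _     | yes refl = ⊥-elim (no-triangle tz (adj-sym wz) (adj-sym yw))
  ...       | no t≢w   | no t≢y   =
    ⊥-elim (no-pentagon x≢z x≢w t≢w t≢y z≢y xt tz (adj-sym wz) (adj-sym yw) (adj-sym xy))

p≢⊤⇒∣p∣≤n∸1 : ∀ {n} {p : Subset n} → p ≢ ⊤ → ∣ p ∣ ≤ n ∸ 1
p≢⊤⇒∣p∣≤n∸1 {zero}  {[]} []≢⊤ = ⊥-elim ([]≢⊤ refl)
p≢⊤⇒∣p∣≤n∸1 {suc n} {p}  p≢⊤  = <⇒≤pred (≤∧≢⇒< (∣p∣≤n p) (p≢⊤ ∘ ∣p∣≡n⇒p≡⊤))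

module Pendant {N} (H : Rel N) {x : Fin N} (pendant : ∀ {a b} → H a x → H x b → a ≡ b) where

  x∉∁⁅x⁆ : ∀ {a} → a ∈ ∁ ⁅ x ⁆ → x ≢ a
  x∉∁⁅x⁆ a∈S refl = x∈∁p⇒x∉p a∈S (x∈⁅x⁆ x)

  bypass : ∀ {k u v} → H u x → Walk H k x v → x ≢ v → ∃[ m ] (m < suc k × Walk H m u v)
  bypass ux (nil _)       x≢v = ⊥-elim (x≢v refl)
  bypass ux (cons xy p) _ with pendant ux xy
  ... | refl = _ , m<n⇒m<1+n (n<1+n _) , p

  shortcut : ∀ {k u v} {p : Walk H k u v} → OnWalk x p → x ≢ u → x ≢ v →
    ∃[ m ] (m < k × Walk H m u v)
  shortcut on-nil         x≢u _   = ⊥-elim (x≢u refl)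
  shortcut (on-head _ _)  x≢u _   = ⊥-elim (x≢u refl)
  shortcut (on-tail {v = y} e p x∈p) _ x≢v with x ≟ y
  ... | yes refl = bypass e p x≢v
  ... | no x≢y with shortcut x∈p x≢y x≢v
  ...   | m , m<k , q = suc m , s≤s m<k , cons e q

  ∁⁅x⁆-convex : Convex H (∁ ⁅ x ⁆)
  ∁⁅x⁆-convex a b k a∈S b∈S (_ , minimal) p y y∈p with y ≟ x
  ... | no y≢x   = x∉p⇒x∈∁p (x≢y⇒x∉⁅y⁆ y≢x)
  ... | yes refl with shortcut y∈p (x∉∁⁅x⁆ a∈S) (x∉∁⁅x⁆ b∈S)
  ...   | m , m<k , q = ⊥-elim (minimal m m<k q)

  ∁⁅x⁆≢⊤ : ∁ ⁅ x ⁆ ≢ ⊤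
  ∁⁅x⁆≢⊤ S≡⊤ = x∉∁⁅x⁆ (subst (x ∈_) (sym S≡⊤) ∈⊤) refl

  convexityNumber : ConvexityNumber H (N ∸ 1)
  convexityNumber =
    (∁ ⁅ x ⁆ , ∁⁅x⁆-convex , ∁⁅x⁆≢⊤ , trans (∣∁p∣≡n∸∣p∣ ⁅ x ⁆) (cong (N ∸_) (∣⁅x⁆∣≡1 x))) ,
    λ _ _ → p≢⊤⇒∣p∣≤n∸1

module DominatingVertex {n} {G : Rel n} (symmetric : ∀ u v → G u v → G v u)
  {c : Fin n} (dominating : ∀ x → x ≢ c → G c x) where

  prismNeighbourˡ : ∀ s → PrismAdj⊎ G s (inj₂ c) → s ≡ inj₁ c
  prismNeighbourˡ (inj₁ _) refl           = refl
  prismNeighbourˡ (inj₂ x) (x≢c , ¬Gxc) = ⊥-elim (¬Gxc (symmetric _ _ (dominating x x≢c)))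

  prismNeighbourʳ : ∀ s → PrismAdj⊎ G (inj₂ c) s → s ≡ inj₁ c
  prismNeighbourʳ (inj₁ _) refl           = refl
  prismNeighbourʳ (inj₂ x) (c≢x , ¬Gcx) = ⊥-elim (¬Gcx (dominating x (c≢x ∘ sym)))

  c̄-pendant : ∀ {a b} → ComplementaryPrism G a (n ↑ʳ c) → ComplementaryPrism G (n ↑ʳ c) b → a ≡ b
  c̄-pendant {a} {b} ac̄ c̄b =
    trans (sym (splitAt⁻¹-↑ˡ (prismNeighbourˡ (splitAt n a) (subst (PrismAdj⊎ G (splitAt n a)) split-c̄ ac̄))))
          (splitAt⁻¹-↑ˡ (prismNeighbourʳ (splitAt n b) (subst (λ s → PrismAdj⊎ G s (splitAt n b)) split-c̄ c̄b)))
    where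
    split-c̄ : splitAt n (n ↑ʳ c) ≡ inj₂ c
    split-c̄ = splitAt-↑ʳ n n c

theorem3p12 : ∀ (n : ℕ) (T : Rel n) → IsTree T → Diameter T 2 →
    ConvexityNumber (ComplementaryPrism T) (2 * n ∸ 1)
theorem3p12 n T (simple , _ , acyclic) (within2 , u , v , cons uc (cons cv (nil _)) , geodesic) =
  subst (ConvexityNumber (ComplementaryPrism T)) (cong (λ m → n + m ∸ 1) (sym (+-identityʳ n)))
    (Pendant.convexityNumber (ComplementaryPrism T) c̄-pendant)
  where
  u≢v : u ≢ v
  u≢v refl = geodesic 0 (s≤s z≤n) (nil u)
  open DiameterAtMostTwo simple acyclic within2 using (centre-dominates)
  open DominatingVertex (proj₁ simple) (centre-dominates uc cv u≢v) using (c̄-pendant)
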